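{- Let $k\ge2$. For every $\epsilon>0$, $\mathrm{Pol}(\mathbf K_k,\mathbf K_{2k})$ satisfies some $\epsilon$-robust bipartite minor condition.
   Context: $\mathbf K_n$ has domain $\{0,\dots,n-1\}$ and the binary relation $\ne$; $\mathrm{Pol}(\mathbf K_k,\mathbf K_c)$ is the set of maps $f\colon\{0,\dots,k-1\}^n\to\{0,\dots,c-1\}$ with $f(\mathbf a)\ne f(\mathbf b)$ whenever $a_i\ne b_i$ for all $i$. A bipartite minor condition over disjoint symbol sets $\mathcal U,\mathcal V$ is a finite set $\Sigma$ of identities $f(x_1,\dots,x_n)\approx g(x_{\pi(1)},\dots,x_{\pi(m)})$, $f\in\mathcal U$, $g\in\mathcal V$, $\pi\colon[m]\to[n]$; it is satisfied in a set of functions if some arity-preserving assignment makes every identity an equality of functions; a set of identities is trivial if satisfied by projections on a set with at least two elements. $\Sigma$ is $\epsilon$-robust if no subset of $\Sigma$ consisting of an $\epsilon$-fraction of its identities is trivial. -}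

module Defs where

open import Data.Nat using (ℕ)
open import Data.Fin using (Fin)
open import Data.Fin.Subset using (Subset; _∈_; ∣_∣)
open import Data.Vec using (Vec; lookup)
open import Data.Maybe using (Maybe; just)
open import Data.Product using (Σ; ∃; _×_; _,_)
open import Data.Integer using (+_)
open import Data.Rational using (ℚ; _/_; _*_; _≤_; _<_; 0ℚ)
open import Relation.Binary.PropositionalEquality using (_≡_; _≢_)
open import Relation.Nullary using (¬_)

-- K_n : domain Fin n with relation ≢.
-- Pol(K_k, K_c) of arity n: maps (Fin n → Fin k) → Fin c that map
-- coordinatewise-distinct tuples to distinct values.
record Pol (k c n : ℕ) : Set where
  field
    fun  : (Fin n → Fin k) → Fin c
    poly : ∀ (a b : Fin n → Fin k) → (∀ i → a i ≢ b i) → fun a ≢ fun b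
open Pol public

-- A bipartite minor condition: symbols Fin u (the set 𝒰) and Fin v (the set 𝒱),
-- with arities; N identities, identity j being
--   f(x_1..x_n) ≈ g(x_{π(1)},...,x_{π(m)})   with n = arU f, m = arV g,
-- π stored as a vector (π(i) = lookup π i).
record Identity {u v : ℕ} (arU : Fin u → ℕ) (arV : Fin v → ℕ) : Set where
  constructor ident
  field
    lhs : Fin u
    rhs : Fin v
    π   : Vec (Fin (arU lhs)) (arV rhs)
open Identity public

record BipartiteMC : Set where
  field
    u v  : ℕ
    arU  : Fin u → ℕ
    arV  : Fin v → ℕ
    N    : ℕ
    ids  : Fin N → Identity arU arV
    -- Σ is a *set* of identities: the listed identities are pairwise distinct.
    distinct : ∀ i j → ids i ≡ ids j → i ≡ j
open BipartiteMC public

SatisfiedInPol : ℕ → ℕ → BipartiteMC → Set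
SatisfiedInPol k c Σ' =
  Σ ((f : Fin (u Σ')) → Pol k c (arU Σ' f)) λ F →
  Σ ((g : Fin (v Σ')) → Pol k c (arV Σ' g)) λ G →
    ∀ (j : Fin (N Σ')) → ∀ (x : Fin (arU Σ' (lhs (ids Σ' j))) → Fin k) →
      fun (F (lhs (ids Σ' j))) x ≡ fun (G (rhs (ids Σ' j))) (λ i → x (lookup (π (ids Σ' j)) i))

-- The subset S of identities of Σ is trivial: satisfied by projections on the
-- two-element set Fin 2.  Only symbols occurring in S need an interpretation,
-- so the assignment is partial (Maybe); each symbol occurring in S gets a projection
-- (given by its coordinate) and each identity in S holds as an equality of functions.
TrivialSubset : (Σ' : BipartiteMC) → Subset (N Σ') → Set
TrivialSubset Σ' S =
  Σ ((f : Fin (u Σ')) → Maybe (Fin (arU Σ' f))) λ pU →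
  Σ ((g : Fin (v Σ')) → Maybe (Fin (arV Σ' g))) λ pV →
    ∀ (j : Fin (N Σ')) → j ∈ S →
      Σ (Fin (arU Σ' (lhs (ids Σ' j)))) λ a →
      Σ (Fin (arV Σ' (rhs (ids Σ' j)))) λ b →
        (pU (lhs (ids Σ' j)) ≡ just a) × (pV (rhs (ids Σ' j)) ≡ just b) ×
        (∀ (x : Fin (arU Σ' (lhs (ids Σ' j))) → Fin 2) → x a ≡ x (lookup (π (ids Σ' j)) b))

ℕtoℚ : ℕ → ℚ
ℕtoℚ n = (+ n) / 1

Robust : ℚ → BipartiteMC → Set
Robust ε Σ' = ∀ (S : Subset (N Σ')) → ε * ℕtoℚ (N Σ') ≤ ℕtoℚ ∣ S ∣ → ¬ TrivialSubset Σ' S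

module Submission where

-- For n identities (n = 4d, d the denominator of ε) let g have one
-- coordinate per cell of the n × n grid and let f have coordinates x₀, …, xₙ.
-- Identity j reads x₀ on the cross of j (row j together with column j) and its
-- private variable x_{j+1} everywhere else:
--     f(x₀, …, xₙ) ≈ g(y),   y(r, c) = x₀ if j ∈ {r, c},  x_{j+1} otherwise.
-- Satisfiability: take f(x) = x₀ and let g(y) be the centre colour of a cross on
-- which y is constant, or a colour from a second palette of k colours if there is
-- none.  Since any two crosses meet, g maps disjoint tuples to distinct colours.
-- Robustness: under projections onto coordinate a of f and cell (r, c) of g, only
-- the identities r, c and a − 1 hold, so a trivial subset has at most 3 members,
-- fewer than an ε-fraction of 4d identities.

open import Defs
open import Data.Nat using (ℕ; _≥_; _*_)
open import Data.Product using (Σ; _×_)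
open import Data.Rational using (ℚ; _<_; 0ℚ)

open import Data.Nat as ℕ using (suc; z≤n; s≤s)
import Data.Nat.Properties as ℕP
open import Data.Integer as ℤ using (+_; -[1+_]; +<+; +≤+)
import Data.Integer.Properties as ℤP
open import Data.Rational as Q using (mkℚ)
import Data.Rational.Properties as QP
open import Data.Rational.Unnormalised as U using (mkℚᵘ; *≤*)
import Data.Rational.Unnormalised.Properties as UP
open import Data.Bool using (true; false; if_then_else_)
open import Data.Sum using (_⊎_; inj₁; inj₂)
open import Data.Product using (_,_; proj₁; proj₂; ∃)
open import Data.Fin as F using (Fin; zero; suc; _↑ˡ_; _↑ʳ_; remQuot; combine; splitAt)
import Data.Fin.Properties as FP
open import Data.Fin.Subset as SS using (Subset; ⁅_⁆; _∪_; ∣_∣; _⊆_)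
import Data.Fin.Subset.Properties as SP
open import Data.Vec using ([]; _∷_; tabulate; lookup)
import Data.Vec.Properties as VP
open import Data.Maybe using (fromMaybe)
open import Relation.Nullary using (Dec; yes; no; does; contradiction)
open import Relation.Nullary.Decidable using (_→-dec_; _⊎-dec_; dec-true)
open import Relation.Binary.PropositionalEquality

toℚᵘ-ℕtoℚ : ∀ n → Q.toℚᵘ (ℕtoℚ n) U.≃ mkℚᵘ (+ n) 0
toℚᵘ-ℕtoℚ n = QP.toℚᵘ-fromℚᵘ (mkℚᵘ (+ n) 0)

ℕtoℚ-cancel-≤ : ∀ {m n} → ℕtoℚ m Q.≤ ℕtoℚ n → m ℕ.≤ n
ℕtoℚ-cancel-≤ {m} {n} m≤n
  with UP.≤-respʳ-≃ (toℚᵘ-ℕtoℚ n) (UP.≤-respˡ-≃ (toℚᵘ-ℕtoℚ m) (QP.toℚᵘ-mono-≤ m≤n))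
... | *≤* m*1≤n*1 rewrite ℤP.*-identityʳ (+ m) | ℤP.*-identityʳ (+ n) = ℤP.drop‿+≤+ m*1≤n*1

-- A positive rational ε = p/d satisfies ε · (m·d) = p·m ≥ m.
ℕtoℚ-≤-scaled : ∀ ε → 0ℚ < ε → ∀ m → ℕtoℚ m Q.≤ ε Q.* ℕtoℚ (m ℕ.* ℚ.denominatorℕ ε)
ℕtoℚ-≤-scaled ε@(mkℚ (+ suc p) d-1 _) _ m = QP.toℚᵘ-cancel-≤ (begin
  Q.toℚᵘ (ℕtoℚ m)                        ≃⟨ toℚᵘ-ℕtoℚ m ⟩
  mkℚᵘ (+ m) 0                            ≤⟨ m≤ε·m·d ⟩
  Q.toℚᵘ ε U.* mkℚᵘ (+ (m ℕ.* d)) 0      ≃⟨ UP.*-congˡ {Q.toℚᵘ ε} (toℚᵘ-ℕtoℚ (m ℕ.* d)) ⟨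
  Q.toℚᵘ ε U.* Q.toℚᵘ (ℕtoℚ (m ℕ.* d))   ≃⟨ QP.toℚᵘ-homo-* ε (ℕtoℚ (m ℕ.* d)) ⟨
  Q.toℚᵘ (ε Q.* ℕtoℚ (m ℕ.* d))          ∎)
  where
  open UP.≤-Reasoning
  d = suc d-1
  -- cross-multiplied, the inequality is m·d ≤ p·(m·d), up to factors 1
  m·d≤p·m·d : m ℕ.* (d ℕ.* 1) ℕ.≤ suc p ℕ.* (m ℕ.* d) ℕ.* 1
  m·d≤p·m·d = subst₂ ℕ._≤_ (cong (m ℕ.*_) (sym (ℕP.*-identityʳ d))) (sym (ℕP.*-identityʳ _))
                (ℕP.m≤n*m (m ℕ.* d) (suc p))
  m≤ε·m·d : mkℚᵘ (+ m) 0 U.≤ Q.toℚᵘ ε U.* mkℚᵘ (+ (m ℕ.* d)) 0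
  m≤ε·m·d = *≤* (subst₂ ℤ._≤_ (ℤP.pos-* m (d ℕ.* 1))
                  (trans (ℤP.pos-* (suc p ℕ.* (m ℕ.* d)) 1)
                         (cong (ℤ._* + 1) (ℤP.pos-* (suc p) (m ℕ.* d))))
                  (+≤+ m·d≤p·m·d))
ℕtoℚ-≤-scaled (mkℚ (+ 0) _ _) (Q.*<* (+<+ ())) m
ℕtoℚ-≤-scaled (mkℚ -[1+ _ ] _ _) (Q.*<* ()) m

robust-if-trivial-subsets-small : ∀ ε → 0ℚ < ε → ∀ b (Σ' : BipartiteMC) →
  N Σ' ≡ suc b ℕ.* ℚ.denominatorℕ ε →
  (∀ S → TrivialSubset Σ' S → ∣ S ∣ ℕ.≤ b) → Robust ε Σ'
robust-if-trivial-subsets-small ε ε>0 b Σ' N≡ small S εN≤∣S∣ trivial =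
  ℕP.<⇒≱ (s≤s (small S trivial)) (ℕtoℚ-cancel-≤ (QP.≤-trans (ℕtoℚ-≤-scaled ε ε>0 (suc b))
    (subst (λ N → ε Q.* ℕtoℚ N Q.≤ ℕtoℚ ∣ S ∣) N≡ εN≤∣S∣)))

∣p∪q∣≤∣p∣+∣q∣ : ∀ {n} (p q : Subset n) → ∣ p ∪ q ∣ ℕ.≤ ∣ p ∣ ℕ.+ ∣ q ∣
∣p∪q∣≤∣p∣+∣q∣ []          []          = z≤n
∣p∪q∣≤∣p∣+∣q∣ (true ∷ p)  (true ∷ q)  = s≤s (ℕP.≤-trans (∣p∪q∣≤∣p∣+∣q∣ p q) (ℕP.+-monoʳ-≤ ∣ p ∣ (ℕP.n≤1+n ∣ q ∣)))
∣p∪q∣≤∣p∣+∣q∣ (true ∷ p)  (false ∷ q) = s≤s (∣p∪q∣≤∣p∣+∣q∣ p q)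
∣p∪q∣≤∣p∣+∣q∣ (false ∷ p) (true ∷ q)  = ℕP.≤-trans (s≤s (∣p∪q∣≤∣p∣+∣q∣ p q)) (ℕP.≤-reflexive (sym (ℕP.+-suc ∣ p ∣ ∣ q ∣)))
∣p∪q∣≤∣p∣+∣q∣ (false ∷ p) (false ∷ q) = ∣p∪q∣≤∣p∣+∣q∣ p q

∣⁅r⁆∪⁅c⁆∪⁅t⁆∣≤3 : ∀ {n} (r c t : Fin n) → ∣ ⁅ r ⁆ ∪ (⁅ c ⁆ ∪ ⁅ t ⁆) ∣ ℕ.≤ 3
∣⁅r⁆∪⁅c⁆∪⁅t⁆∣≤3 r c t = ℕP.≤-trans (∣p∪q∣≤∣p∣+∣q∣ ⁅ r ⁆ (⁅ c ⁆ ∪ ⁅ t ⁆))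
  (ℕP.+-mono-≤ (ℕP.≤-reflexive (SP.∣⁅x⁆∣≡1 r))
    (ℕP.≤-trans (∣p∪q∣≤∣p∣+∣q∣ ⁅ c ⁆ ⁅ t ⁆)
      (ℕP.≤-reflexive (cong₂ ℕ._+_ (SP.∣⁅x⁆∣≡1 c) (SP.∣⁅x⁆∣≡1 t)))))

-- Projections onto distinct coordinates differ on some Boolean tuple, so an
-- identity x_a ≈ x_{a'} holding for all Boolean tuples forces a ≡ a'.
projections-separate : ∀ {n} (a a' : Fin n) → (∀ (x : Fin n → Fin 2) → x a ≡ x a') → a ≡ a'
projections-separate a a' same
  with a F.≟ a' | same (λ i → if does (i F.≟ a') then suc zero else zero)
... | yes a≡a' | _ = a≡a'
... | no _ | indicator-agrees rewrite dec-true (a' F.≟ a') refl with () ← indicator-agrees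

-- The colours Fin (2k) = Fin (k + (k + 0)) form two palettes of k colours each.
inl : ∀ {k} → Fin k → Fin (2 * k)
inl {k} i = i ↑ˡ (k ℕ.+ 0)

inr : ∀ {k} → Fin k → Fin (2 * k)
inr {k} i = k ↑ʳ (i ↑ˡ 0)

inl-injective : ∀ {k} {i j : Fin k} → inl i ≡ inl j → i ≡ j
inl-injective {k} = FP.↑ˡ-injective (k ℕ.+ 0) _ _

inr-injective : ∀ {k} {i j : Fin k} → inr i ≡ inr j → i ≡ j
inr-injective {k} eq = FP.↑ˡ-injective 0 _ _ (FP.↑ʳ-injective k _ _ eq)

inl≢inr : ∀ {k} (i j : Fin k) → inl i ≢ inr j
inl≢inr {k} i j eq
  with trans (sym (FP.splitAt-↑ˡ k i (k ℕ.+ 0)))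
             (trans (cong (splitAt k) eq) (FP.splitAt-↑ʳ k (k ℕ.+ 0) (j ↑ˡ 0)))
... | ()

module Construction (k m : ℕ) where

  n : ℕ
  n = suc m

  Cell : Set
  Cell = Fin (n * n)

  cell : Fin n → Fin n → Cell
  cell = combine

  row col : Cell → Fin n
  row b = proj₁ (remQuot {n} n b)
  col b = proj₂ (remQuot {n} n b)

  row-cell : ∀ r c → row (cell r c) ≡ r
  row-cell r c = cong proj₁ (FP.remQuot-combine {n} {n} r c)

  col-cell : ∀ r c → col (cell r c) ≡ c
  col-cell r c = cong proj₂ (FP.remQuot-combine {n} {n} r c)

  OnCross : Fin n → Cell → Set
  OnCross j b = row b ≡ j ⊎ col b ≡ j

  onCross? : ∀ j b → Dec (OnCross j b)
  onCross? j b = (row b F.≟ j) ⊎-dec (col b F.≟ j)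

  -- Any two crosses meet: cell (j, j') lies on the crosses of j and of j'.
  cell-onCrossˡ : ∀ j j' → OnCross j (cell j j')
  cell-onCrossˡ j j' = inj₁ (row-cell j j')

  cell-onCrossʳ : ∀ j j' → OnCross j' (cell j j')
  cell-onCrossʳ j j' = inj₂ (col-cell j j')

  minor : Fin n → Cell → Fin (suc n)
  minor j b with onCross? j b
  ... | yes _ = zero
  ... | no _  = suc j

  minor-onCross : ∀ j b → OnCross j b → minor j b ≡ zero
  minor-onCross j b on with onCross? j b
  ... | yes _  = refl
  ... | no off = contradiction on off

  minor-cases : ∀ j b a → minor j b ≡ a → OnCross j b ⊎ suc j ≡ a
  minor-cases j b a eq with onCross? j b
  ... | yes on = inj₁ on
  ... | no _   = inj₂ eq

  arityU arityV : Fin 1 → ℕ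
  arityU _ = suc n
  arityV _ = n * n

  identity : Fin n → Identity arityU arityV
  identity j = ident zero zero (tabulate (minor j))

  -- Distinct j give distinct identities: minor j sends the cell (i, i) to x₀ only if j ≡ i.
  identity-injective : ∀ i j → identity i ≡ identity j → i ≡ j
  identity-injective i j same with minor-cases j (cell i i) zero minor-j≡0
    where
    minor-j≡0 : minor j (cell i i) ≡ zero
    minor-j≡0 = begin
      minor j (cell i i)                         ≡⟨ VP.lookup∘tabulate (minor j) (cell i i) ⟨
      lookup (tabulate (minor j)) (cell i i)     ≡⟨ cong (λ π → lookup π (cell i i)) (cong Identity.π same) ⟨
      lookup (tabulate (minor i)) (cell i i)     ≡⟨ VP.lookup∘tabulate (minor i) (cell i i) ⟩
      minor i (cell i i)                         ≡⟨ minor-onCross i (cell i i) (cell-onCrossˡ i i) ⟩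
      zero                                       ∎
      where open ≡-Reasoning
  ... | inj₁ (inj₁ row≡j) = trans (sym (row-cell i i)) row≡j
  ... | inj₁ (inj₂ col≡j) = trans (sym (col-cell i i)) col≡j

  condition : BipartiteMC
  condition = record
    { u = 1 ; v = 1 ; arU = arityU ; arV = arityV
    ; N = n ; ids = identity ; distinct = identity-injective }

  firstCoordinate : Pol k (2 * k) (suc n)
  firstCoordinate = record
    { fun  = λ x → inl (x zero)
    ; poly = λ x x' disjoint same → disjoint zero (inl-injective same) }

  MonochromaticCross : Fin n → (Cell → Fin k) → Set
  MonochromaticCross j y = ∀ b → OnCross j b → y b ≡ y (cell j j)

  monochromaticCross? : ∀ y → Dec (∃ λ j → MonochromaticCross j y)
  monochromaticCross? y =
    FP.any? (λ j → FP.all? (λ b → onCross? j b →-dec (y b F.≟ y (cell j j))))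

  crossColour : (y : Cell → Fin k) → Dec (∃ λ j → MonochromaticCross j y) → Fin (2 * k)
  crossColour y (yes (j , _)) = inl (y (cell j j))
  crossColour y (no _)        = inr (y zero)

  -- Disjoint tuples get distinct colours: two monochromatic crosses meet in a cell,
  -- where the tuples would have to agree.
  crossColour-disjoint : ∀ y y' → (∀ b → y b ≢ y' b) →
    ∀ d d' → crossColour y d ≢ crossColour y' d'
  crossColour-disjoint y y' disjoint (yes (j , mono)) (yes (j' , mono')) same =
    disjoint (cell j j') (begin
      y (cell j j')    ≡⟨ mono (cell j j') (cell-onCrossˡ j j') ⟩
      y (cell j j)     ≡⟨ inl-injective same ⟩
      y' (cell j' j')  ≡⟨ mono' (cell j j') (cell-onCrossʳ j j') ⟨
      y' (cell j j')   ∎)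
    where open ≡-Reasoning
  crossColour-disjoint y y' _        (yes _) (no _)  same = inl≢inr _ _ same
  crossColour-disjoint y y' _        (no _)  (yes _) same = inl≢inr _ _ (sym same)
  crossColour-disjoint y y' disjoint (no _)  (no _)  same = disjoint zero (inr-injective same)

  crossPolymorphism : Pol k (2 * k) (n * n)
  crossPolymorphism = record
    { fun  = λ y → crossColour y (monochromaticCross? y)
    ; poly = λ y y' disjoint →
        crossColour-disjoint y y' disjoint (monochromaticCross? y) (monochromaticCross? y') }

  -- If y has the constant colour c on the cross of j, then g(y) is c from the first
  -- palette, because every monochromatic cross meets the cross of j.
  crossColour-constant : ∀ y j c → (∀ b → OnCross j b → y b ≡ c) →
    ∀ d → crossColour y d ≡ inl c
  crossColour-constant y j c constant (yes (j' , mono')) = cong inl (begin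
    y (cell j' j')  ≡⟨ mono' (cell j j') (cell-onCrossʳ j j') ⟨
    y (cell j j')   ≡⟨ constant (cell j j') (cell-onCrossˡ j j') ⟩
    c               ∎)
    where open ≡-Reasoning
  crossColour-constant y j c constant (no none) = contradiction (j , mono) none
    where
    mono : MonochromaticCross j y
    mono b on = trans (constant b on) (sym (constant (cell j j) (cell-onCrossˡ j j)))

  minor-reads-x₀ : ∀ j (x : Fin (suc n) → Fin k) b → OnCross j b →
    x (lookup (tabulate (minor j)) b) ≡ x zero
  minor-reads-x₀ j x b on =
    cong x (trans (VP.lookup∘tabulate (minor j) b) (minor-onCross j b on))

  satisfied : SatisfiedInPol k (2 * k) condition
  satisfied = (λ _ → firstCoordinate) , (λ _ → crossPolymorphism) , λ j x →
    let y = λ b → x (lookup (tabulate (minor j)) b) in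
    sym (crossColour-constant y j (x zero) (minor-reads-x₀ j x) (monochromaticCross? y))

  -- The identity whose private variable is x_a (for a = 0 the choice is irrelevant).
  owner : Fin (suc n) → Fin n
  owner zero    = zero
  owner (suc j) = j

  trivial-identity : ∀ j a b →
    (∀ (x : Fin (suc n) → Fin 2) → x a ≡ x (lookup (tabulate (minor j)) b)) →
    j SS.∈ ⁅ row b ⁆ ∪ (⁅ col b ⁆ ∪ ⁅ owner a ⁆)
  trivial-identity j a b holds
    with minor-cases j b a
           (sym (trans (projections-separate _ _ holds) (VP.lookup∘tabulate (minor j) b)))
  ... | inj₁ (inj₁ row≡j) =
    SP.x∈p∪q⁺ (inj₁ (subst (SS._∈ ⁅ row b ⁆) row≡j (SP.x∈⁅x⁆ (row b))))
  ... | inj₁ (inj₂ col≡j) =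
    SP.x∈p∪q⁺ (inj₂ (SP.x∈p∪q⁺ (inj₁ (subst (SS._∈ ⁅ col b ⁆) col≡j (SP.x∈⁅x⁆ (col b))))))
  ... | inj₂ refl =
    SP.x∈p∪q⁺ (inj₂ (SP.x∈p∪q⁺ (inj₂ (SP.x∈⁅x⁆ j))))

  trivial-subset-small : ∀ S → TrivialSubset condition S → ∣ S ∣ ℕ.≤ 3
  trivial-subset-small S (pU , pV , trivial) =
    ℕP.≤-trans (SP.p⊆q⇒∣p∣≤∣q∣ S⊆) (∣⁅r⁆∪⁅c⁆∪⁅t⁆∣≤3 (row b) (col b) (owner a))
    where
    a : Fin (suc n)
    a = fromMaybe zero (pU zero)
    b : Cell
    b = fromMaybe zero (pV zero)
    S⊆ : S ⊆ ⁅ row b ⁆ ∪ (⁅ col b ⁆ ∪ ⁅ owner a ⁆)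
    S⊆ {j} j∈S with trivial j j∈S
    ... | a' , b' , pU≡a' , pV≡b' , holds rewrite pU≡a' | pV≡b' = trivial-identity j a' b' holds

-- The theorem, with n = 4d identities for d the denominator of ε; the construction
-- works for every k.
proposition10p2 : ∀ (k : ℕ) → k ≥ 2 → ∀ (ε : ℚ) → 0ℚ < ε →
    Σ BipartiteMC λ Σ' → Robust ε Σ' × SatisfiedInPol k (2 * k) Σ'
proposition10p2 k _ ε ε>0 = condition , robust , satisfied
  where
  open Construction k (ℕ.pred (4 * ℚ.denominatorℕ ε))
  robust : Robust ε condition
  robust = robust-if-trivial-subsets-small ε ε>0 3 condition refl trivial-subset-small
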